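{- Let $\Gamma$ be a set of statements, $P,Q,S\in\mathsf{T}$, $m,n\in\omega$ and $x\in\mathsf{V}\setminus(\mathsf{F}(\Gamma)\cup\mathsf{F}(Q))$, and suppose $\Gamma\vDash(Q:\mathsf{u}_m)$. If $\Gamma\cup\{(x:Q)\}\vDash(S:P)$ and $\Gamma\cup\{(x:Q)\}\vDash(P:\mathsf{u}_n)$, then $\Gamma\vDash(\lambda xQS:\pi_m^nxQP)$.
   Context: Set-theoretic conventions: for sets $R,s$, $\mathrm{dom}(R)=\{d\mid\exists r\,\langle r,d\rangle\in R\}$, $R(s)=\bigcup\{r\mid\langle r,s\rangle\in R\}$; a function $F$ is a set of pairs $\langle F(d),d\rangle$; $Y^X$ is the set of functions from $X$ to $Y$; for a function $\phi$, $\prod\phi$ is the set of functions $f$ on $\mathrm{dom}(\phi)$ with $f(d)\in\phi(d)$. Terms: constants $\mathsf{C}$, variables $\mathsf{V}$; $\mathsf{T}$ is the smallest set of strings containing $\mathsf{C}\cup\mathsf{V}$ and $\beta RS$ (written $RS$) and $\lambda xRS$. Free variables: $\mathsf{F}(a)=\emptyset$, $\mathsf{F}(x)=\{x\}$, $\mathsf{F}(RS)=\mathsf{F}(R)\cup\mathsf{F}(S)$, $\mathsf{F}(\lambda xRS)=\mathsf{F}(R)\cup(\mathsf{F}(S)\setminus\{x\})$. Among the constants are pairwise distinct sorts $\mathsf{u}_n$ and operators $\mathsf{p}_m^n$. $\pi_m^nxQP$ denotes $\mathsf{p}_m^nQ(\lambda xQP)$. Interpretations: any assignment of sets to variables and to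 constants other than the $\mathsf{p}_m^n$ extends uniquely to $\llbracket\cdot\rrbracket$ on $\mathsf{T}$ with $\llbracket\mathsf{p}_m^n\rrbracket$ the function on $\llbracket\mathsf{u}_m\rrbracket$ sending $D$ to the function on $\llbracket\mathsf{u}_n\rrbracket^D$ sending $\phi$ to $\prod\phi$; $\llbracket RS\rrbracket=\llbracket R\rrbracket(\llbracket S\rrbracket)$; $\llbracket\lambda xRS\rrbracket=\{\langle\llbracket S\rrbracket_{\langle r,x\rangle},r\rangle\mid r\in\llbracket R\rrbracket\}$ ($\llbracket\cdot\rrbracket_{\langle r,x\rangle}$: assignment changed to $r$ at $x$; $\llbracket\cdot\rrbracket_\psi$: changed to agree with a function $\psi$ from variables to sets). Well-formedness: atomic terms are well-formed; $FS$ is well-formed iff $F,S$ are, $\llbracket F\rrbracket$ is a function and $\llbracket S\rrbracket\in\mathrm{dom}\llbracket F\rrbracket$; $\lambda xRS$ is well-formed iff $R$ is and $S$ is under $\llbracket\cdot\rrbracket_{\langle r,x\rangle}$ for all $r\in\llbracket R\rrbracket$. Statements are of three kinds: typing statements $(S:P)$, reduction statements $R\twoheadrightarrow C$ and sub-reduction statements $R\triangleright C$ (with $R,C,S,P\in\mathsf{T}$). An interpretation satisfies $(S:P)$ iff $S,P$ are well-formed and $\llbracket S\rrbracket\in\llbracket P\rrbracket$; it satisfies $R\twoheadrightarrow C$ (resp. $R\triangleright C$) iff for every function $\psi$ from variables to sets, whenever $R$ is well-formed w.r.t. $\llbracket\cdot\rrbracket_\psi$, so is $C$ and $\llbracket R\rrbracket_\psi=\llbracket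 C\rrbracket_\psi$ (resp. $\subseteq$). $\Gamma\vDash X$ means every interpretation satisfying all statements of $\Gamma$ satisfies $X$. $\mathsf{F}(\Gamma)$ is the union of $\mathsf{F}(S)\cup\mathsf{F}(P)$ over the typing statements $(S:P)\in\Gamma$. -}

module Defs where

open import Level using (0ℓ)
open import Data.Nat using (ℕ)
open import Data.Nat.Properties using (_≟_)
open import Data.Product using (Σ; ∃; _×_; _,_)
open import Data.Sum using (_⊎_)
open import Data.Unit using (⊤)
open import Data.Empty using (⊥)
open import Relation.Nullary using (¬_; yes; no)
open import Relation.Binary.PropositionalEquality using (_≡_)
open import Function.Bundles using (_⇔_)

-- The paper works in ordinary (ZF-style) set theory.  Agda has no such
-- universe built in, so we quantify over an arbitrary model of
-- (full-separation) set theory, given by a carrier V, a membership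
-- relation, extensionality (stated with Agda's equality on V), and the
-- set-forming operations with their defining membership conditions.

record SetTheory : Set₁ where
  infix 4 _∈_
  field
    V    : Set
    _∈_  : V → V → Set
    ext  : ∀ {a b} → (∀ z → (z ∈ a) ⇔ (z ∈ b)) → a ≡ b
    upair : V → V → V
    upair-∈ : ∀ {a b z} → (z ∈ upair a b) ⇔ (z ≡ a ⊎ z ≡ b)
    ⋃    : V → V
    ⋃-∈  : ∀ {a z} → (z ∈ ⋃ a) ⇔ (∃ λ y → y ∈ a × z ∈ y)
    𝒫    : V → V
    𝒫-∈  : ∀ {a z} → (z ∈ 𝒫 a) ⇔ (∀ w → w ∈ z → w ∈ a)
    sep  : V → (V → Set) → V
    sep-∈ : ∀ {a φ z} → (z ∈ sep a φ) ⇔ (z ∈ a × φ z)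
    repl : V → (V → V) → V
    repl-∈ : ∀ {a f z} → (z ∈ repl a f) ⇔ (∃ λ y → y ∈ a × z ≡ f y)

data Term (K : Set) : Set where
  var  : ℕ → Term K
  sort : ℕ → Term K
  op   : ℕ → ℕ → Term K
  con  : K → Term K
  app  : Term K → Term K → Term K
  lam  : ℕ → Term K → Term K → Term K

π : {K : Set} → ℕ → ℕ → ℕ → Term K → Term K → Term K
π m n x Q P = app (app (op m n) Q) (lam x Q P)

Free : {K : Set} → ℕ → Term K → Set
Free x (var y)     = x ≡ y
Free x (sort _)    = ⊥
Free x (op _ _)    = ⊥
Free x (con _)     = ⊥
Free x (app R S)   = Free x R ⊎ Free x S
Free x (lam y R S) = Free x R ⊎ (Free x S × ¬ (x ≡ y))

data Stmt (K : Set) : Set where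
  typing : Term K → Term K → Stmt K
  red    : Term K → Term K → Stmt K
  subred : Term K → Term K → Stmt K

Ctx : Set → Set₁
Ctx K = Stmt K → Set

_,∶_ : {K : Set} → Ctx K → Stmt K → Ctx K
(Γ ,∶ X) Y = Γ Y ⊎ Y ≡ X

FreeCtx : {K : Set} → ℕ → Ctx K → Set
FreeCtx {K} x Γ = Σ (Term K) λ S → Σ (Term K) λ P →
  Γ (typing S P) × (Free x S ⊎ Free x P)

module _ (T : SetTheory) where
  open SetTheory T

  _∪_ : V → V → V
  a ∪ b = ⋃ (upair a b)

  sing : V → V
  sing a = upair a a

  ⟨_,_⟩ : V → V → V
  ⟨ a , b ⟩ = upair (sing a) (upair a b)

  dom : V → V
  dom R = sep (⋃ (⋃ R)) (λ d → ∃ λ r → ⟨ r , d ⟩ ∈ R)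

  ran : V → V
  ran R = sep (⋃ (⋃ R)) (λ r → ∃ λ d → ⟨ r , d ⟩ ∈ R)

  ap : V → V → V
  ap R s = ⋃ (sep (⋃ (⋃ R)) (λ r → ⟨ r , s ⟩ ∈ R))

  -- F is a function: a set of pairs ⟨F(d), d⟩, single-valued
  IsFunction : V → Set
  IsFunction F =
    (∀ z → z ∈ F → ∃ λ r → ∃ λ d → z ≡ ⟨ r , d ⟩) ×
    (∀ r r′ d → ⟨ r , d ⟩ ∈ F → ⟨ r′ , d ⟩ ∈ F → r ≡ r′)

  _⇒_ : V → V → V
  X ⇒ Y = sep (𝒫 (𝒫 (𝒫 (X ∪ Y))))
            (λ F → IsFunction F × dom F ≡ X × (∀ r d → ⟨ r , d ⟩ ∈ F → r ∈ Y))

  ∏ : V → V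
  ∏ φ = sep (dom φ ⇒ ⋃ (ran φ)) (λ f → ∀ d → d ∈ dom φ → ap f d ∈ ap φ d)

  opSem : V → V → V
  opSem A B = repl A (λ D → ⟨ repl (D ⇒ B) (λ φ → ⟨ ∏ φ , φ ⟩) , D ⟩)

  record Interp (K : Set) : Set where
    field
      ρ : ℕ → V
      σ : ℕ → V
      κ : K → V

  update : (ℕ → V) → ℕ → V → (ℕ → V)
  update ρ x r y with y ≟ x
  ... | yes _ = r
  ... | no  _ = ρ y

  ⟦_⟧ : {K : Set} → Term K → (σ : ℕ → V) (κ : K → V) (ρ : ℕ → V) → V
  ⟦ var x ⟧     σ κ ρ = ρ x
  ⟦ sort n ⟧    σ κ ρ = σ n
  ⟦ op m n ⟧    σ κ ρ = opSem (σ m) (σ n)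
  ⟦ con k ⟧     σ κ ρ = κ k
  ⟦ app R S ⟧   σ κ ρ = ap (⟦ R ⟧ σ κ ρ) (⟦ S ⟧ σ κ ρ)
  ⟦ lam x R S ⟧ σ κ ρ =
    repl (⟦ R ⟧ σ κ ρ) (λ r → ⟨ ⟦ S ⟧ σ κ (update ρ x r) , r ⟩)

  WF : {K : Set} → Term K → (σ : ℕ → V) (κ : K → V) (ρ : ℕ → V) → Set
  WF (var _)     σ κ ρ = ⊤
  WF (sort _)    σ κ ρ = ⊤
  WF (op _ _)    σ κ ρ = ⊤
  WF (con _)     σ κ ρ = ⊤
  WF (app F S)   σ κ ρ = WF F σ κ ρ × WF S σ κ ρ ×
                         IsFunction (⟦ F ⟧ σ κ ρ) × ⟦ S ⟧ σ κ ρ ∈ dom (⟦ F ⟧ σ κ ρ)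
  WF (lam x R S) σ κ ρ = WF R σ κ ρ ×
                         (∀ r → r ∈ ⟦ R ⟧ σ κ ρ → WF S σ κ (update ρ x r))

  Sat : {K : Set} → Interp K → Stmt K → Set
  Sat I (typing S P) = WF S σ κ ρ × WF P σ κ ρ × ⟦ S ⟧ σ κ ρ ∈ ⟦ P ⟧ σ κ ρ
    where open Interp I
  Sat I (red R C) = ∀ (ψ : ℕ → V) → WF R σ κ ψ →
                      WF C σ κ ψ × ⟦ R ⟧ σ κ ψ ≡ ⟦ C ⟧ σ κ ψ
    where open Interp I
  Sat I (subred R C) = ∀ (ψ : ℕ → V) → WF R σ κ ψ →
                      WF C σ κ ψ × (∀ z → z ∈ ⟦ R ⟧ σ κ ψ → z ∈ ⟦ C ⟧ σ κ ψ)
    where open Interp I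

  _⊨_ : {K : Set} → Ctx K → Stmt K → Set
  _⊨_ {K} Γ X = (I : Interp K) → (∀ Y → Γ Y → Sat I Y) → Sat I X

{-# OPTIONS --safe #-}
-- The abstraction λxQS denotes the graph r ↦ ⟦S⟧[x≔r] over ⟦Q⟧, and the
-- product π x Q P denotes ∏ of the graph r ↦ ⟦P⟧[x≔r]. Since x is free neither
-- in Γ nor in Q, updating x to any r ∈ ⟦Q⟧ in a model of Γ yields a model of
-- Γ ∪ {(x : Q)}; there ⟦S⟧ ∈ ⟦P⟧ ∈ ⟦u_n⟧, which is exactly what membership of
-- the first graph in the product of the second requires.
module Submission where

open import Defs
open import Data.Nat using (ℕ)
open import Data.Nat.Properties using (_≟_)
open import Relation.Nullary using (¬_; yes; no)
open import Data.Product using (∃; _×_; _,_; proj₁; proj₂)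
open import Data.Sum using (_⊎_; inj₁; inj₂)
open import Data.Unit using (tt)
open import Data.Empty using (⊥-elim)
open import Relation.Binary.PropositionalEquality
  using (_≡_; refl; sym; trans; subst; subst₂; cong; cong₂)
open import Function.Base using (_∘_)
open import Function.Bundles using (mk⇔; Equivalence)

module Semantics (T : SetTheory) where
  open SetTheory T
  open Equivalence

  pair : V → V → V
  pair = ⟨_,_⟩ T

  upair-introˡ : ∀ {a b} → a ∈ upair a b
  upair-introˡ = from upair-∈ (inj₁ refl)

  upair-introʳ : ∀ {a b} → b ∈ upair a b
  upair-introʳ = from upair-∈ (inj₂ refl)

  sing-elim : ∀ {a z} → z ∈ upair a a → z ≡ a
  sing-elim z∈ with to upair-∈ z∈
  ... | inj₁ z≡a = z≡a
  ... | inj₂ z≡a = z≡a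

  ∈-∈-pair-elim : ∀ {y z c d} → y ∈ z → z ∈ pair c d → y ≡ c ⊎ y ≡ d
  ∈-∈-pair-elim y∈z z∈ with to upair-∈ z∈
  ... | inj₁ refl = inj₁ (sing-elim y∈z)
  ... | inj₂ refl = to upair-∈ y∈z

  fst-∈-∈-pair : ∀ {z c d} → z ∈ pair c d → c ∈ z
  fst-∈-∈-pair z∈ with to upair-∈ z∈
  ... | inj₁ refl = upair-introˡ
  ... | inj₂ refl = upair-introˡ

  pair-injective : ∀ {a b c d} → pair a b ≡ pair c d → a ≡ c × b ≡ d
  pair-injective {a} {b} {c} {d} e = a≡c , b≡d
    where
      a≡c : a ≡ c
      a≡c = sym (sing-elim (fst-∈-∈-pair (subst (upair a a ∈_) e upair-introˡ)))
      b≡d : b ≡ d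
      b≡d with ∈-∈-pair-elim upair-introʳ (subst (upair c d ∈_) (sym e) upair-introʳ)
      ... | inj₂ d≡b = sym d≡b
      ... | inj₁ d≡a with ∈-∈-pair-elim upair-introʳ (subst (upair a b ∈_) e upair-introʳ)
      ...   | inj₂ b≡d = b≡d
      ...   | inj₁ b≡c = trans b≡c (trans (sym a≡c) (sym d≡a))

  components-∈-⋃⋃ : ∀ {r d R} → pair r d ∈ R → r ∈ ⋃ (⋃ R) × d ∈ ⋃ (⋃ R)
  components-∈-⋃⋃ {r} {d} p =
    from ⋃-∈ (upair r r , from ⋃-∈ (pair r d , p , upair-introˡ) , upair-introˡ) ,
    from ⋃-∈ (upair r d , from ⋃-∈ (pair r d , p , upair-introʳ) , upair-introʳ)

  ∪-introˡ : ∀ {a b z} → z ∈ a → z ∈ _∪_ T a b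
  ∪-introˡ {a} z∈a = from ⋃-∈ (a , upair-introˡ , z∈a)

  ∪-introʳ : ∀ {a b z} → z ∈ b → z ∈ _∪_ T a b
  ∪-introʳ {b = b} z∈b = from ⋃-∈ (b , upair-introʳ , z∈b)

  ran-intro : ∀ {r d R} → pair r d ∈ R → r ∈ ran T R
  ran-intro {d = d} p = from sep-∈ (proj₁ (components-∈-⋃⋃ p) , d , p)

  ap-≡ : ∀ {F v s} → IsFunction T F → pair v s ∈ F → ap T F s ≡ v
  ap-≡ {F} {v} {s} (_ , single-valued) p = ext λ z → mk⇔ (⊆v z) (λ z∈v →
    from ⋃-∈ (v , from sep-∈ (proj₁ (components-∈-⋃⋃ p) , p) , z∈v))
    where
      ⊆v : ∀ z → z ∈ ap T F s → z ∈ v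
      ⊆v z z∈ with to ⋃-∈ z∈
      ... | y , y∈ , z∈y = subst (z ∈_) (single-valued y v s (proj₂ (to sep-∈ y∈)) p) z∈y

  Applicable : V → V → Set
  Applicable F a = IsFunction T F × a ∈ dom T F

  graph : V → (V → V) → V
  graph A f = repl A (λ a → pair (f a) a)

  module _ {A : V} (f : V → V) where

    graph-intro : ∀ {a} → a ∈ A → pair (f a) a ∈ graph A f
    graph-intro {a} a∈A = from repl-∈ (a , a∈A , refl)

    graph-elim : ∀ {r d} → pair r d ∈ graph A f → d ∈ A × r ≡ f d
    graph-elim p with to repl-∈ p
    ... | a , a∈A , e with pair-injective e
    ...   | r≡fa , refl = a∈A , r≡fa

    graph-isFunction : IsFunction T (graph A f)
    graph-isFunction = isPairs , single-valued
      where
        isPairs : ∀ z → z ∈ graph A f → ∃ λ r → ∃ λ d → z ≡ pair r d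
        isPairs z z∈ with to repl-∈ z∈
        ... | a , _ , e = f a , a , e
        single-valued : ∀ r r′ d → pair r d ∈ graph A f → pair r′ d ∈ graph A f → r ≡ r′
        single-valued r r′ d p q = trans (proj₂ (graph-elim p)) (sym (proj₂ (graph-elim q)))

    dom-graph : dom T (graph A f) ≡ A
    dom-graph = ext λ z → mk⇔ (⊆A z) (λ z∈A →
      from sep-∈ (proj₂ (components-∈-⋃⋃ (graph-intro z∈A)) , f z , graph-intro z∈A))
      where
        ⊆A : ∀ z → z ∈ dom T (graph A f) → z ∈ A
        ⊆A z z∈ with to sep-∈ z∈
        ... | _ , _ , p = proj₁ (graph-elim p)

    ap-graph : ∀ {a} → a ∈ A → ap T (graph A f) a ≡ f a
    ap-graph a∈A = ap-≡ graph-isFunction (graph-intro a∈A)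

    graph-applicable : ∀ {a} → a ∈ A → Applicable (graph A f) a
    graph-applicable a∈A = graph-isFunction , subst (_ ∈_) (sym dom-graph) a∈A

    graph-∈-⇒ : ∀ {Y} → (∀ a → a ∈ A → f a ∈ Y) → graph A f ∈ _⇒_ T A Y
    graph-∈-⇒ {Y} f∈Y = from sep-∈ (graph∈𝒫𝒫𝒫 , graph-isFunction , dom-graph , ran⊆Y)
      where
        ran⊆Y : ∀ r d → pair r d ∈ graph A f → r ∈ Y
        ran⊆Y r d p = subst (_∈ Y) (sym (proj₂ (graph-elim p))) (f∈Y d (proj₁ (graph-elim p)))
        atoms⊆A∪Y : ∀ w → w ∈ graph A f → ∀ u → u ∈ w → ∀ t → t ∈ u → t ∈ _∪_ T A Y
        atoms⊆A∪Y w w∈ u u∈w t t∈u with to repl-∈ w∈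
        ... | a , a∈A , refl with ∈-∈-pair-elim t∈u u∈w
        ...   | inj₁ refl = ∪-introʳ (f∈Y a a∈A)
        ...   | inj₂ refl = ∪-introˡ a∈A
        graph∈𝒫𝒫𝒫 : graph A f ∈ 𝒫 (𝒫 (𝒫 (_∪_ T A Y)))
        graph∈𝒫𝒫𝒫 = from 𝒫-∈ λ w w∈ → from 𝒫-∈ λ u u∈w → from 𝒫-∈ λ t t∈u →
          atoms⊆A∪Y w w∈ u u∈w t t∈u

  graph-cong : ∀ {A A′ f g} → A ≡ A′ → (∀ a → a ∈ A′ → f a ≡ g a) → graph A f ≡ graph A′ g
  graph-cong {A} {f = f} {g} refl f≗g = ext λ z → mk⇔ (⊆ f≗g z) (⊆ (λ a a∈A → sym (f≗g a a∈A)) z)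
    where
      ⊆ : ∀ {h k} → (∀ a → a ∈ A → h a ≡ k a) → ∀ z → z ∈ graph A h → z ∈ graph A k
      ⊆ {h} {k} h≗k z z∈ with to repl-∈ z∈
      ... | a , a∈A , e = from repl-∈ (a , a∈A , trans e (cong (λ v → pair v a) (h≗k a a∈A)))

  graph-∈-∏ : ∀ {A} f g → (∀ a → a ∈ A → f a ∈ g a) → graph A f ∈ ∏ T (graph A g)
  graph-∈-∏ {A} f g f∈g = from sep-∈ (graph-∈-⇒-ran , ap-∈-ap)
    where
      ⋃ran : V
      ⋃ran = ⋃ (ran T (graph A g))
      graph-∈-⇒-ran : graph A f ∈ _⇒_ T (dom T (graph A g)) ⋃ran
      graph-∈-⇒-ran = subst (λ D → graph A f ∈ _⇒_ T D ⋃ran) (sym (dom-graph g))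
        (graph-∈-⇒ f λ a a∈A → from ⋃-∈ (g a , ran-intro (graph-intro g a∈A) , f∈g a a∈A))
      ap-∈-ap : ∀ d → d ∈ dom T (graph A g) → ap T (graph A f) d ∈ ap T (graph A g) d
      ap-∈-ap d d∈ = subst₂ _∈_ (sym (ap-graph f d∈A)) (sym (ap-graph g d∈A)) (f∈g d d∈A)
        where d∈A = subst (d ∈_) (dom-graph g) d∈

  module _ {A B D Φ : V} (D∈A : D ∈ A) where

    ap-opSem : ap T (opSem T A B) D ≡ graph (_⇒_ T D B) (∏ T)
    ap-opSem = ap-graph (λ D′ → graph (_⇒_ T D′ B) (∏ T)) D∈A

    ap-opSem-applicable : Φ ∈ _⇒_ T D B → Applicable (ap T (opSem T A B) D) Φ
    ap-opSem-applicable Φ∈ = subst (λ F → Applicable F Φ) (sym ap-opSem) (graph-applicable (∏ T) Φ∈)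

    ap-ap-opSem : Φ ∈ _⇒_ T D B → ap T (ap T (opSem T A B) D) Φ ≡ ∏ T Φ
    ap-ap-opSem Φ∈ = trans (cong (λ F → ap T F Φ) ap-opSem) (ap-graph (∏ T) Φ∈)

  AgreeOn : {K : Set} → Term K → (ℕ → V) → (ℕ → V) → Set
  AgreeOn t ρ ρ′ = ∀ y → Free y t → ρ y ≡ ρ′ y

  update-≡ : ∀ ρ x r → update T ρ x r x ≡ r
  update-≡ ρ x r with x ≟ x
  ... | yes _ = refl
  ... | no x≢x = ⊥-elim (x≢x refl)

  update-fresh : ∀ {K x} (t : Term K) ρ r → ¬ Free x t → AgreeOn t ρ (update T ρ x r)
  update-fresh {x = x} t ρ r x∉t y y∈t with y ≟ x
  ... | yes refl = ⊥-elim (x∉t y∈t)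
  ... | no _ = refl

  update-AgreeOn-body : ∀ {K} y (R S : Term K) {ρ ρ′} r → AgreeOn (lam y R S) ρ ρ′ →
                        AgreeOn S (update T ρ y r) (update T ρ′ y r)
  update-AgreeOn-body y R S r ρ≈ρ′ z z∈S with z ≟ y
  ... | yes _ = refl
  ... | no z≢y = ρ≈ρ′ z (inj₂ (z∈S , z≢y))

  module _ {K : Set} (σ : ℕ → V) (κ : K → V) where

    ⟦⟧-coincidence : ∀ (t : Term K) {ρ ρ′} → AgreeOn t ρ ρ′ → ⟦_⟧ T t σ κ ρ ≡ ⟦_⟧ T t σ κ ρ′
    ⟦⟧-coincidence (var x)     ρ≈ρ′ = ρ≈ρ′ x refl
    ⟦⟧-coincidence (sort _)    ρ≈ρ′ = refl
    ⟦⟧-coincidence (op _ _)    ρ≈ρ′ = refl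
    ⟦⟧-coincidence (con _)     ρ≈ρ′ = refl
    ⟦⟧-coincidence (app F S)   ρ≈ρ′ =
      cong₂ (ap T) (⟦⟧-coincidence F (λ y → ρ≈ρ′ y ∘ inj₁)) (⟦⟧-coincidence S (λ y → ρ≈ρ′ y ∘ inj₂))
    ⟦⟧-coincidence (lam y R S) ρ≈ρ′ =
      graph-cong (⟦⟧-coincidence R (λ z → ρ≈ρ′ z ∘ inj₁))
                 (λ r _ → ⟦⟧-coincidence S (update-AgreeOn-body y R S r ρ≈ρ′))

    WF-coincidence : ∀ (t : Term K) {ρ ρ′} → AgreeOn t ρ ρ′ → WF T t σ κ ρ → WF T t σ κ ρ′
    WF-coincidence (var _)     ρ≈ρ′ _ = tt
    WF-coincidence (sort _)    ρ≈ρ′ _ = tt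
    WF-coincidence (op _ _)    ρ≈ρ′ _ = tt
    WF-coincidence (con _)     ρ≈ρ′ _ = tt
    WF-coincidence (app F S)   ρ≈ρ′ (wf-F , wf-S , F-applicable) =
      WF-coincidence F ρ≈ρ′ᶠ wf-F , WF-coincidence S ρ≈ρ′ˢ wf-S ,
      subst₂ Applicable (⟦⟧-coincidence F ρ≈ρ′ᶠ) (⟦⟧-coincidence S ρ≈ρ′ˢ) F-applicable
      where
        ρ≈ρ′ᶠ = λ y → ρ≈ρ′ y ∘ inj₁
        ρ≈ρ′ˢ = λ y → ρ≈ρ′ y ∘ inj₂
    WF-coincidence (lam y R S) ρ≈ρ′ (wf-R , wf-S) =
      WF-coincidence R ρ≈ρ′ᴿ wf-R ,
      λ r r∈R → WF-coincidence S (update-AgreeOn-body y R S r ρ≈ρ′)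
                  (wf-S r (subst (r ∈_) (sym (⟦⟧-coincidence R ρ≈ρ′ᴿ)) r∈R))
      where
        ρ≈ρ′ᴿ = λ z → ρ≈ρ′ z ∘ inj₁

  module _ {K : Set} where

    _[_≔_] : Interp T K → ℕ → V → Interp T K
    I [ x ≔ r ] = record I { ρ = update T (Interp.ρ I) x r }

    ⟦_⟧ᴵ : Term K → Interp T K → V
    ⟦ t ⟧ᴵ I = ⟦_⟧ T t (Interp.σ I) (Interp.κ I) (Interp.ρ I)

    WFᴵ : Term K → Interp T K → Set
    WFᴵ t I = WF T t (Interp.σ I) (Interp.κ I) (Interp.ρ I)

    Satisfies : Interp T K → Ctx K → Set
    Satisfies I Γ = ∀ Y → Γ Y → Sat T I Y

    Sat-typing-fresh : ∀ I {x} r (S P : Term K) → ¬ Free x S → ¬ Free x P →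
                       Sat T I (typing S P) → Sat T (I [ x ≔ r ]) (typing S P)
    Sat-typing-fresh I r S P x∉S x∉P (wf-S , wf-P , S∈P) =
      WF-coincidence σ κ S S≈ wf-S , WF-coincidence σ κ P P≈ wf-P ,
      subst₂ _∈_ (⟦⟧-coincidence σ κ S S≈) (⟦⟧-coincidence σ κ P P≈) S∈P
      where
        open Interp I
        S≈ = update-fresh S ρ r x∉S
        P≈ = update-fresh P ρ r x∉P

    -- Only typing statements mention the variable assignment; the others
    -- quantify over all assignments.
    Satisfies-fresh : ∀ I {x} r {Γ : Ctx K} → ¬ FreeCtx x Γ →
                      Satisfies I Γ → Satisfies (I [ x ≔ r ]) Γ
    Satisfies-fresh I r x∉Γ I⊨Γ (typing S P) Γ∋ =
      Sat-typing-fresh I r S P (x∉Γ ∘ λ x∈S → S , P , Γ∋ , inj₁ x∈S)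
                               (x∉Γ ∘ λ x∈P → S , P , Γ∋ , inj₂ x∈P) (I⊨Γ _ Γ∋)
    Satisfies-fresh I r x∉Γ I⊨Γ (red R C)    Γ∋ = I⊨Γ _ Γ∋
    Satisfies-fresh I r x∉Γ I⊨Γ (subred R C) Γ∋ = I⊨Γ _ Γ∋

    Satisfies-extend : ∀ I {x} r {Γ : Ctx K} {Q} → ¬ FreeCtx x Γ → ¬ Free x Q →
                       Satisfies I Γ → WFᴵ Q I → r ∈ ⟦ Q ⟧ᴵ I →
                       Satisfies (I [ x ≔ r ]) (Γ ,∶ typing (var x) Q)
    Satisfies-extend I r x∉Γ x∉Q I⊨Γ wf-Q r∈Q Y (inj₁ Γ∋) = Satisfies-fresh I r x∉Γ I⊨Γ Y Γ∋
    Satisfies-extend I {x} r {Q = Q} x∉Γ x∉Q I⊨Γ wf-Q r∈Q _ (inj₂ refl) =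
      tt , WF-coincidence σ κ Q Q≈ wf-Q ,
      subst₂ _∈_ (sym (update-≡ ρ x r)) (⟦⟧-coincidence σ κ Q Q≈) r∈Q
      where
        open Interp I
        Q≈ = update-fresh Q ρ r x∉Q

    Sat-π-intro : ∀ I {m n x} {Q S P : Term K} → Sat T I (typing Q (sort m)) →
                  (∀ r → r ∈ ⟦ Q ⟧ᴵ I → Sat T (I [ x ≔ r ]) (typing S P)) →
                  (∀ r → r ∈ ⟦ Q ⟧ᴵ I → Sat T (I [ x ≔ r ]) (typing P (sort n))) →
                  Sat T I (typing (lam x Q S) (π m n x Q P))
    Sat-π-intro I {m} {n} {x} {Q} {S} {P} (wf-Q , _ , Q∈uₘ) ⊨S∶P ⊨P∶uₙ = wf-λ , wf-π , λ∈π
      where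
        s p : V → V
        s r = ⟦ S ⟧ᴵ (I [ x ≔ r ])
        p r = ⟦ P ⟧ᴵ (I [ x ≔ r ])
        Φ∈uₙ^Q : graph (⟦ Q ⟧ᴵ I) p ∈ _⇒_ T (⟦ Q ⟧ᴵ I) (Interp.σ I n)
        Φ∈uₙ^Q = graph-∈-⇒ p λ r r∈Q → proj₂ (proj₂ (⊨P∶uₙ r r∈Q))
        wf-λ : WFᴵ (lam x Q S) I
        wf-λ = wf-Q , λ r r∈Q → proj₁ (⊨S∶P r r∈Q)
        wf-π : WFᴵ (π m n x Q P) I
        wf-π = (tt , wf-Q , graph-applicable _ Q∈uₘ) ,
               (wf-Q , λ r r∈Q → proj₁ (proj₂ (⊨S∶P r r∈Q))) ,
               ap-opSem-applicable Q∈uₘ Φ∈uₙ^Q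
        λ∈π : ⟦ lam x Q S ⟧ᴵ I ∈ ⟦ π m n x Q P ⟧ᴵ I
        λ∈π = subst (graph (⟦ Q ⟧ᴵ I) s ∈_) (sym (ap-ap-opSem Q∈uₘ Φ∈uₙ^Q))
                    (graph-∈-∏ s p λ r r∈Q → proj₂ (proj₂ (⊨S∶P r r∈Q)))

proposition14p3 : (T : SetTheory) {K : Set} (Γ : Ctx K) (P Q S : Term K) (m n x : ℕ) →
    ¬ FreeCtx x Γ → ¬ Free x Q →
    _⊨_ T Γ (typing Q (sort m)) →
    _⊨_ T (Γ ,∶ typing (var x) Q) (typing S P) →
    _⊨_ T (Γ ,∶ typing (var x) Q) (typing P (sort n)) →
    _⊨_ T Γ (typing (lam x Q S) (π m n x Q P))
proposition14p3 T Γ P Q S m n x x∉Γ x∉Q ⊨Q∶uₘ ⊨S∶P ⊨P∶uₙ I I⊨Γ =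
  Sat-π-intro I Q-sat (λ r r∈Q → ⊨S∶P _ (I[x≔r]⊨Γ,x∶Q r r∈Q))
                      (λ r r∈Q → ⊨P∶uₙ _ (I[x≔r]⊨Γ,x∶Q r r∈Q))
  where
    open SetTheory T using (_∈_)
    open Semantics T
    Q-sat : Sat T I (typing Q (sort m))
    Q-sat = ⊨Q∶uₘ I I⊨Γ
    I[x≔r]⊨Γ,x∶Q : ∀ r → r ∈ ⟦ Q ⟧ᴵ I → Satisfies (I [ x ≔ r ]) (Γ ,∶ typing (var x) Q)
    I[x≔r]⊨Γ,x∶Q r r∈Q = Satisfies-extend I r x∉Γ x∉Q I⊨Γ (proj₁ Q-sat) r∈Q
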